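{- Let $m,d\geq1$ be integers with $\max\{d,m\}\geq2$. Let $\phi(x)=\sum_{i=0}^{d}x^{mi}$, let $\tau$ be the unique positive solution of $\phi(x)=x\phi'(x)$, and set $\alpha=\alpha(m,d)=(\phi'(\tau))^m$. Then there exists a constant $c_a=c_a(m,d)$ such that for every integer $t\geq1$, \[ |\mathcal{D}_m(t(m+1),0,\cdot,d)|\leq c_a\alpha^t. \] Moreover $\alpha\leq\gamma_m:=(m+1)(1+1/m)^m$.
   Context: For an integer $m\geq1$, a partial $m$-Dyck path is a lattice path in the upper half-plane $\{y\geq 0\}$ starting at $(0,0)$ using steps $(1,1)$ (rises) and $(1,-m)$ ($m$-falls). The level of a point is its $y$-coordinate; a full $m$-Dyck path is one ending at level $0$. The maximum descent of a path is the length of a longest run of consecutive $m$-falls. $\mathcal{D}_m(s,0,\cdot,d)$ denotes the set of partial $m$-Dyck paths ending at $(s,0)$ (with no restriction on height) with maximum descent at most $d$. -}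

module Defs where

open import Data.Nat using (ℕ; zero; suc; _+_; _*_; _∸_; _≤_; _⊔_)
open import Data.Nat.Properties using (_≤?_)
import Data.Nat as ℕ
open import Data.Integer as ℤ using (ℤ; +_)
open import Data.Rational as ℚ using (ℚ; _/_)
open import Data.List using (List; []; _∷_; length; filter; concatMap)
open import Data.Maybe using (Maybe; just; nothing)
open import Data.Maybe.Properties using () renaming (≡-dec to maybe-≡-dec)
open import Data.Product using (_×_)
open import Relation.Binary.PropositionalEquality using (_≡_)
open import Relation.Nullary using (Dec; yes; no)
open import Relation.Nullary.Decidable using (_×-dec_)
open import Relation.Unary using (Decidable)

-- rise = step (1,1), fall = step (1,-m)
data Step : Set where
  rise fall : Step

walk : (m : ℕ) → ℕ → List Step → Maybe ℕ
walk m ℓ [] = just ℓ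
walk m ℓ (rise ∷ p) = walk m (suc ℓ) p
walk m ℓ (fall ∷ p) with m ≤? ℓ
... | yes _ = walk m (ℓ ∸ m) p
... | no _  = nothing

-- maximum descent: length of a longest run of consecutive falls.
-- maxRun cur best p : cur = length of current run of falls, best = max so far
maxRun : ℕ → ℕ → List Step → ℕ
maxRun cur best [] = best
maxRun cur best (rise ∷ p) = maxRun 0 best p
maxRun cur best (fall ∷ p) = maxRun (suc cur) (best ⊔ suc cur) p

maxDescent : List Step → ℕ
maxDescent = maxRun 0 0

-- p ∈ D_m(s,0,·,d) (for p of length s): p is a partial m-Dyck path
-- (stays at level ≥ 0) ending at level 0, with maximum descent ≤ d.
InD : (m d : ℕ) → List Step → Set
InD m d p = (walk m 0 p ≡ just 0) × (maxDescent p ≤ d)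

InD? : (m d : ℕ) → Decidable (InD m d)
InD? m d p = maybe-≡-dec ℕ._≟_ (walk m 0 p) (just 0) ×-dec (maxDescent p ≤? d)

allPaths : ℕ → List (List Step)
allPaths zero = [] ∷ []
allPaths (suc s) = concatMap (λ p → (rise ∷ p) ∷ (fall ∷ p) ∷ []) (allPaths s)

countD : (m s d : ℕ) → ℕ
countD m s d = length (filter (InD? m d) (allPaths s))

-- Rational arithmetic helpers (the real constants τ, α are described by
-- rational cuts)

ℕ→ℚ : ℕ → ℚ
ℕ→ℚ n = (+ n) / 1

ℤ→ℚ : ℤ → ℚ
ℤ→ℚ z = z / 1

infixr 8 _^_
_^_ : ℚ → ℕ → ℚ
x ^ zero = ℚ.1ℚ
x ^ suc n = x ℚ.* (x ^ n)

Σ≤ : ℕ → (ℕ → ℚ) → ℚ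
Σ≤ zero f = f 0
Σ≤ (suc n) f = Σ≤ n f ℚ.+ f (suc n)

φ : (m d : ℕ) → ℚ → ℚ
φ m d x = Σ≤ d (λ i → x ^ (m * i))

-- φ'(x) = Σ_{i=0}^{d} (mi) x^{mi-1}  (the i = 0 term is 0)
φ′ : (m d : ℕ) → ℚ → ℚ
φ′ m d x = Σ≤ d (λ i → ℕ→ℚ (m * i) ℚ.* x ^ (m * i ∸ 1))

γ : (m : ℕ) → .{{ℕ.NonZero m}} → ℚ
γ m = ℕ→ℚ (suc m) ℚ.* (((+ suc m) / m) ^ m)

-- Weight a path by y per fall. A path with t(m+1) steps ending at level 0 has t falls and
-- mt rises, and each rise is followed by a run of at most d falls, so y^t · |D_m(t(m+1),0,·,d)|
-- is at most the coefficient sum (1 + y + ⋯ + y^d)^(mt) = φ(x)^(mt) for y = x^m. For x > τ,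
-- i.e. φ(x) < xφ'(x), this is at most (xφ'(x))^(mt), so |D_m(t(m+1),0,·,d)| ≤ (φ'(x)^m)^t and
-- c_a = 1 works.
--
-- For α ≤ γ_m write G = Σ_{i≤d} yⁱ and H = Σ_{i≤d} i yⁱ, so φ(x) = G and xφ'(x) = mH; x < τ
-- means mH < G. AM-GM says that tⁱ lies above its tangent line at t = y; summing at
-- t = w = 1/(m+1) and using G(w) ≤ 1/(1 - w) = (m+1)/m =: Z gives w H < y (Z - (m-1) H).
-- AM-GM once more gives (mH)^m (Z - (m-1) H) ≤ H Z^m = γ_m w H, hence (mH)^m ≤ γ_m y,
-- which is φ'(x)^m ≤ γ_m.

module Submission where

open import Level using (0ℓ)
open import Function using (_∘_)
open import Data.Bool using (true; false)
open import Data.Nat as ℕ using (ℕ; zero; suc; _⊔_; NonZero)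
import Data.Nat.Properties as ℕ
import Data.Nat.Tactic.RingSolver as ℕ-Solver
open import Data.Nat.Coprimality using (1-coprimeTo) renaming (sym to coprime-sym)
open import Data.Integer as ℤ using (+_)
import Data.Integer.Properties as ℤ
open import Data.Rational as ℚ using (ℚ; mkℚ; _/_; 0ℚ; 1ℚ; _+_; _*_; _-_; -_; _≤_; _<_)
import Data.Rational.Properties as ℚ
import Data.Rational.Unnormalised as ℚᵘ
import Data.Rational.Unnormalised.Properties as ℚᵘ
open import Data.List using (List; []; _∷_; length; filter; concatMap)
open import Data.List.Properties using (length-filter; filter-none)
open import Data.List.Relation.Unary.All as All using (All; []; _∷_)
open import Data.List.Relation.Unary.All.Properties using (concat⁺; map⁺)
open import Data.List.Relation.Binary.Sublist.Propositional using (⊆-refl)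
open import Data.List.Relation.Binary.Sublist.Propositional.Properties using (filter⁺; length-mono-≤)
open import Data.Maybe using (just)
open import Data.Maybe.Properties using () renaming (≡-dec to maybe-≡-dec)
open import Data.Product using (_×_; _,_; proj₁; proj₂; map₂; ∃-syntax)
open import Data.Sum using (inj₁; inj₂; [_,_]′)
open import Relation.Binary.PropositionalEquality
open import Relation.Nullary using (¬_; yes; no; does; contradiction)
open import Relation.Nullary.Decidable using (_×-dec_)
open import Relation.Unary using (Pred; Decidable)
open import Data.Rational.Solver using (module +-*-Solver)
open +-*-Solver using (solve; _:+_; _:*_; _:-_; _:=_; con)
open import Defs

p≤q⇒0≤q-p : ∀ {p q} → p ≤ q → 0ℚ ≤ q - p
p≤q⇒0≤q-p {p} {q} p≤q = subst (_≤ q - p) (ℚ.+-inverseʳ p) (ℚ.+-monoˡ-≤ (- p) p≤q)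

-- Sign lemmas of Data.Rational.Properties with order hypotheses in place of sign instances.
*-nonNeg : ∀ {p q} → 0ℚ ≤ p → 0ℚ ≤ q → 0ℚ ≤ p * q
*-nonNeg {p} {q} p≥0 q≥0 =
  ℚ.nonNegative⁻¹ _ {{ℚ.nonNeg*nonNeg⇒nonNeg p {{ℚ.nonNegative p≥0}} q {{ℚ.nonNegative q≥0}}}}

*-pos : ∀ {p q} → 0ℚ < p → 0ℚ < q → 0ℚ < p * q
*-pos {p} {q} p>0 q>0 = ℚ.positive⁻¹ _ {{ℚ.pos*pos⇒pos p {{ℚ.positive p>0}} q {{ℚ.positive q>0}}}}

*-monoˡ-≤ : ∀ {p q} r → 0ℚ ≤ r → p ≤ q → r * p ≤ r * q
*-monoˡ-≤ r r≥0 = ℚ.*-monoˡ-≤-nonNeg r {{ℚ.nonNegative r≥0}}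

*-monoʳ-≤ : ∀ {p q} r → 0ℚ ≤ r → p ≤ q → p * r ≤ q * r
*-monoʳ-≤ r r≥0 = ℚ.*-monoʳ-≤-nonNeg r {{ℚ.nonNegative r≥0}}

*-cancelˡ-≤ : ∀ {p q} r → 0ℚ < r → r * p ≤ r * q → p ≤ q
*-cancelˡ-≤ r r>0 = ℚ.*-cancelˡ-≤-pos r {{ℚ.positive r>0}}

-- In this canonical form, _+_ and _*_ on ℕ→ℚ values reduce to integer arithmetic.
ℕ→ℚ≡mkℚ : ∀ n → ℕ→ℚ n ≡ mkℚ (+ n) 0 (coprime-sym (1-coprimeTo n))
ℕ→ℚ≡mkℚ n = ℚ.↥p/↧p≡p (mkℚ (+ n) 0 (coprime-sym (1-coprimeTo n)))

ℕ→ℚ-+ : ∀ a b → ℕ→ℚ (a ℕ.+ b) ≡ ℕ→ℚ a + ℕ→ℚ b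
ℕ→ℚ-+ a b rewrite ℕ→ℚ≡mkℚ a | ℕ→ℚ≡mkℚ b =
  cong (_/ 1) (trans (ℤ.pos-+ a b) (sym (cong₂ ℤ._+_ (ℤ.*-identityʳ (+ a)) (ℤ.*-identityʳ (+ b)))))

ℕ→ℚ-suc : ∀ n → ℕ→ℚ (suc n) ≡ 1ℚ + ℕ→ℚ n
ℕ→ℚ-suc = ℕ→ℚ-+ 1

ℕ→ℚ-* : ∀ a b → ℕ→ℚ (a ℕ.* b) ≡ ℕ→ℚ a * ℕ→ℚ b
ℕ→ℚ-* a b rewrite ℕ→ℚ≡mkℚ a | ℕ→ℚ≡mkℚ b = cong (_/ 1) (ℤ.pos-* a b)

ℕ→ℚ-mono-≤ : ∀ {a b} → a ℕ.≤ b → ℕ→ℚ a ≤ ℕ→ℚ b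
ℕ→ℚ-mono-≤ {a} {b} a≤b rewrite ℕ→ℚ≡mkℚ a | ℕ→ℚ≡mkℚ b =
  ℚ.*≤* (ℤ.*-monoʳ-≤-nonNeg (+ 1) (ℤ.+≤+ a≤b))

ℕ→ℚ-nonNeg : ∀ n → 0ℚ ≤ ℕ→ℚ n
ℕ→ℚ-nonNeg n = ℕ→ℚ-mono-≤ {0} {n} ℕ.z≤n

/-*-cancel : ∀ n d .{{_ : NonZero d}} → (+ n / d) * ℕ→ℚ d ≡ ℕ→ℚ n
/-*-cancel n d@(suc d-1) = ℚ.toℚᵘ-injective (begin
  ℚ.toℚᵘ (+ n / d * ℕ→ℚ d)                ≈⟨ ℚ.toℚᵘ-homo-* (+ n / d) (ℕ→ℚ d) ⟩
  ℚ.toℚᵘ (+ n / d) ℚᵘ.* ℚ.toℚᵘ (ℕ→ℚ d)    ≈⟨ ℚᵘ.*-cong (ℚ.toℚᵘ-fromℚᵘ (ℚᵘ.mkℚᵘ (+ n) d-1))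
                                                        (ℚ.toℚᵘ-fromℚᵘ (ℚᵘ.mkℚᵘ (+ d) 0)) ⟩
  ℚᵘ.mkℚᵘ (+ n) d-1 ℚᵘ.* ℚᵘ.mkℚᵘ (+ d) 0  ≈⟨ ℚᵘ.*≡* cross-multiplied ⟩
  ℚᵘ.mkℚᵘ (+ n) 0                          ≈⟨ ℚᵘ.≃-sym (ℚ.toℚᵘ-fromℚᵘ (ℚᵘ.mkℚᵘ (+ n) 0)) ⟩
  ℚ.toℚᵘ (ℕ→ℚ n)                           ∎)
  where
  open ℚᵘ.≃-Reasoning
  cross-multiplied : (+ n ℤ.* + d) ℤ.* + 1 ≡ + n ℤ.* + (d ℕ.* 1)
  cross-multiplied = trans (ℤ.*-identityʳ _) (cong (λ e → + n ℤ.* + e) (sym (ℕ.*-identityʳ d)))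

^-distribˡ-+-* : ∀ x a b → x ^ (a ℕ.+ b) ≡ x ^ a * x ^ b
^-distribˡ-+-* x zero    b = sym (ℚ.*-identityˡ (x ^ b))
^-distribˡ-+-* x (suc a) b = trans (cong (x *_) (^-distribˡ-+-* x a b)) (sym (ℚ.*-assoc x (x ^ a) (x ^ b)))

^-*-assoc : ∀ x a b → (x ^ a) ^ b ≡ x ^ (a ℕ.* b)
^-*-assoc x a zero    = sym (cong (x ^_) (ℕ.*-zeroʳ a))
^-*-assoc x a (suc b) = begin
  x ^ a * (x ^ a) ^ b    ≡⟨ cong (x ^ a *_) (^-*-assoc x a b) ⟩
  x ^ a * x ^ (a ℕ.* b)  ≡⟨ ^-distribˡ-+-* x a (a ℕ.* b) ⟨
  x ^ (a ℕ.+ a ℕ.* b)    ≡⟨ cong (x ^_) (ℕ.*-suc a b) ⟨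
  x ^ (a ℕ.* suc b)      ∎
  where open ≡-Reasoning

^-distribʳ-* : ∀ x y n → (x * y) ^ n ≡ x ^ n * y ^ n
^-distribʳ-* x y zero    = refl
^-distribʳ-* x y (suc n) = trans (cong (x * y *_) (^-distribʳ-* x y n)) (interchange x y (x ^ n) (y ^ n))
  where
  interchange : ∀ a b c d → a * b * (c * d) ≡ a * c * (b * d)
  interchange = solve 4 (λ a b c d → a :* b :* (c :* d) := a :* c :* (b :* d)) refl

^-nonNeg : ∀ {x} n → 0ℚ ≤ x → 0ℚ ≤ x ^ n
^-nonNeg zero    _   = ℚ.nonNegative⁻¹ 1ℚ
^-nonNeg (suc n) x≥0 = *-nonNeg x≥0 (^-nonNeg n x≥0)

^-pos : ∀ {x} n → 0ℚ < x → 0ℚ < x ^ n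
^-pos zero    _   = ℚ.positive⁻¹ 1ℚ
^-pos (suc n) x>0 = *-pos x>0 (^-pos n x>0)

^-mono-≤ : ∀ {x y} n → 0ℚ ≤ x → x ≤ y → x ^ n ≤ y ^ n
^-mono-≤ zero    _   _   = ℚ.≤-refl
^-mono-≤ (suc n) x≥0 x≤y =
  ℚ.≤-trans (*-monoʳ-≤ _ (^-nonNeg n x≥0) x≤y) (*-monoˡ-≤ _ (ℚ.≤-trans x≥0 x≤y) (^-mono-≤ n x≥0 x≤y))

^-rearrangement-ordered : ∀ n {a b} → 0ℚ ≤ a → a ≤ b → a ^ n * b + a * b ^ n ≤ a ^ suc n + b ^ suc n
^-rearrangement-ordered n {a} {b} a≥0 a≤b = begin
  a ^ n * b + a * b ^ n                    ≡⟨ split a b (a ^ n) (b ^ n) ⟩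
  a ^ suc n + a * b ^ n + (b - a) * a ^ n
    ≤⟨ ℚ.+-monoʳ-≤ (a ^ suc n + a * b ^ n) (*-monoˡ-≤ (b - a) (p≤q⇒0≤q-p a≤b) (^-mono-≤ n a≥0 a≤b)) ⟩
  a ^ suc n + a * b ^ n + (b - a) * b ^ n  ≡⟨ merge a b (a ^ n) (b ^ n) ⟩
  a ^ suc n + b ^ suc n                    ∎
  where
  open ℚ.≤-Reasoning
  split : ∀ a b A B → A * b + a * B ≡ a * A + a * B + (b - a) * A
  split = solve 4 (λ a b A B → A :* b :+ a :* B := a :* A :+ a :* B :+ (b :- a) :* A) refl
  merge : ∀ a b A B → a * A + a * B + (b - a) * B ≡ a * A + b * B
  merge = solve 4 (λ a b A B → a :* A :+ a :* B :+ (b :- a) :* B := a :* A :+ b :* B) refl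

^-rearrangement : ∀ n {a b} → 0ℚ ≤ a → 0ℚ ≤ b → a ^ n * b + a * b ^ n ≤ a ^ suc n + b ^ suc n
^-rearrangement n {a} {b} a≥0 b≥0 with ℚ.≤-total a b
... | inj₁ a≤b = ^-rearrangement-ordered n a≥0 a≤b
... | inj₂ b≤a = begin
  a ^ n * b + a * b ^ n  ≡⟨ swap a b (a ^ n) (b ^ n) ⟩
  b ^ n * a + b * a ^ n  ≤⟨ ^-rearrangement-ordered n b≥0 b≤a ⟩
  b ^ suc n + a ^ suc n  ≡⟨ ℚ.+-comm (b ^ suc n) (a ^ suc n) ⟩
  a ^ suc n + b ^ suc n  ∎
  where
  open ℚ.≤-Reasoning
  swap : ∀ a b A B → A * b + a * B ≡ B * a + b * A
  swap = solve 4 (λ a b A B → A :* b :+ a :* B := B :* a :+ b :* A) refl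

amgm : ∀ k {a b} → 0ℚ ≤ a → 0ℚ ≤ b → ℕ→ℚ (suc k) * (a ^ k * b) ≤ b ^ suc k + ℕ→ℚ k * a ^ suc k
amgm zero    {a} {b} _ _ = ℚ.≤-reflexive (base a b)
  where
  base : ∀ a b → 1ℚ * (1ℚ * b) ≡ b * 1ℚ + 0ℚ * (a * 1ℚ)
  base = solve 2 (λ a b → con 1ℚ :* (con 1ℚ :* b) := b :* con 1ℚ :+ con 0ℚ :* (a :* con 1ℚ)) refl
amgm (suc k) {a} {b} a≥0 b≥0 = begin
  ℕ→ℚ (suc (suc k)) * (a ^ suc k * b)                ≡⟨ cong (_* (a ^ suc k * b)) (ℕ→ℚ-suc (suc k)) ⟩
  (1ℚ + ℕ→ℚ (suc k)) * (a ^ suc k * b)               ≡⟨ peel a b (a ^ k) (ℕ→ℚ (suc k)) ⟩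
  a * (ℕ→ℚ (suc k) * (a ^ k * b)) + a ^ suc k * b    ≤⟨ ℚ.+-monoˡ-≤ (a ^ suc k * b) (*-monoˡ-≤ a a≥0 (amgm k a≥0 b≥0)) ⟩
  a * (b ^ suc k + ℕ→ℚ k * a ^ suc k) + a ^ suc k * b ≡⟨ regroup a b (a ^ suc k) (b ^ suc k) (ℕ→ℚ k) ⟩
  (a ^ suc k * b + a * b ^ suc k) + ℕ→ℚ k * a ^ suc (suc k)
      ≤⟨ ℚ.+-monoˡ-≤ (ℕ→ℚ k * a ^ suc (suc k)) (^-rearrangement (suc k) a≥0 b≥0) ⟩
  (a ^ suc (suc k) + b ^ suc (suc k)) + ℕ→ℚ k * a ^ suc (suc k)
      ≡⟨ collect (a ^ suc (suc k)) (b ^ suc (suc k)) (ℕ→ℚ k) ⟩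
  b ^ suc (suc k) + (1ℚ + ℕ→ℚ k) * a ^ suc (suc k)
      ≡⟨ cong (λ c → b ^ suc (suc k) + c * a ^ suc (suc k)) (ℕ→ℚ-suc k) ⟨
  b ^ suc (suc k) + ℕ→ℚ (suc k) * a ^ suc (suc k)   ∎
  where
  open ℚ.≤-Reasoning
  peel : ∀ a b A K → (1ℚ + K) * (a * A * b) ≡ a * (K * (A * b)) + a * A * b
  peel = solve 4 (λ a b A K → (con 1ℚ :+ K) :* (a :* A :* b) := a :* (K :* (A :* b)) :+ a :* A :* b) refl
  regroup : ∀ a b A B K → a * (B + K * A) + A * b ≡ (A * b + a * B) + K * (a * A)
  regroup = solve 5 (λ a b A B K →
    a :* (B :+ K :* A) :+ A :* b := (A :* b :+ a :* B) :+ K :* (a :* A)) refl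
  collect : ∀ A B K → (A + B) + K * A ≡ B + (1ℚ + K) * A
  collect = solve 3 (λ A B K → (A :+ B) :+ K :* A := B :+ (con 1ℚ :+ K) :* A) refl

amgm-scaled : ∀ k {h z} → 0ℚ ≤ h → 0ℚ ≤ z →
  (ℕ→ℚ (suc k) * h) ^ suc k * (z - ℕ→ℚ k * h) ≤ h * z ^ suc k
amgm-scaled k {h} {z} h≥0 z≥0 = begin
  a ^ suc k * (z - K * h)                    ≡⟨ expand M h (a ^ k) z K ⟩
  h * (M * (a ^ k * z)) - K * h * a ^ suc k  ≤⟨ ℚ.+-monoˡ-≤ (- (K * h * a ^ suc k)) (*-monoˡ-≤ h h≥0 (amgm k a≥0 z≥0)) ⟩
  h * (z ^ suc k + K * a ^ suc k) - K * h * a ^ suc k  ≡⟨ cancel h (z ^ suc k) K (a ^ suc k) ⟩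
  h * z ^ suc k                              ∎
  where
  open ℚ.≤-Reasoning
  expand : ∀ M h A z K → M * h * A * (z - K * h) ≡ h * (M * (A * z)) - K * h * (M * h * A)
  expand = solve 5 (λ M h A z K →
    M :* h :* A :* (z :- K :* h) := h :* (M :* (A :* z)) :- K :* h :* (M :* h :* A)) refl
  cancel : ∀ h Y K A → h * (Y + K * A) - K * h * A ≡ h * Y
  cancel = solve 4 (λ h Y K A → h :* (Y :+ K :* A) :- K :* h :* A := h :* Y) refl
  M = ℕ→ℚ (suc k)
  K = ℕ→ℚ k
  a = M * h
  a≥0 = *-nonNeg (ℕ→ℚ-nonNeg (suc k)) h≥0

-- Truncated geometric sums

Σ≤-cong : ∀ n {f g : ℕ → ℚ} → (∀ i → f i ≡ g i) → Σ≤ n f ≡ Σ≤ n g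
Σ≤-cong zero    f≡g = f≡g 0
Σ≤-cong (suc n) f≡g = cong₂ _+_ (Σ≤-cong n f≡g) (f≡g (suc n))

Σ≤-mono-≤ : ∀ n {f g : ℕ → ℚ} → (∀ i → f i ≤ g i) → Σ≤ n f ≤ Σ≤ n g
Σ≤-mono-≤ zero    f≤g = f≤g 0
Σ≤-mono-≤ (suc n) f≤g = ℚ.+-mono-≤ (Σ≤-mono-≤ n f≤g) (f≤g (suc n))

Σ≤-nonNeg : ∀ n {f : ℕ → ℚ} → (∀ i → 0ℚ ≤ f i) → 0ℚ ≤ Σ≤ n f
Σ≤-nonNeg zero    f≥0 = f≥0 0
Σ≤-nonNeg (suc n) f≥0 = ℚ.+-mono-≤ (Σ≤-nonNeg n f≥0) (f≥0 (suc n))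

Σ≤-linear : ∀ n a b (f g : ℕ → ℚ) → a * Σ≤ n f + b * Σ≤ n g ≡ Σ≤ n (λ i → a * f i + b * g i)
Σ≤-linear zero    a b f g = refl
Σ≤-linear (suc n) a b f g = trans (distrib a b (Σ≤ n f) (Σ≤ n g) (f (suc n)) (g (suc n)))
                                  (cong (_+ (a * f (suc n) + b * g (suc n))) (Σ≤-linear n a b f g))
  where
  distrib : ∀ a b F G x y → a * (F + x) + b * (G + y) ≡ (a * F + b * G) + (a * x + b * y)
  distrib = solve 6 (λ a b F G x y →
    a :* (F :+ x) :+ b :* (G :+ y) := (a :* F :+ b :* G) :+ (a :* x :+ b :* y)) refl

Σ≤-unroll : ∀ n (f : ℕ → ℚ) → Σ≤ (suc n) f ≡ f 0 + Σ≤ n (f ∘ suc)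
Σ≤-unroll zero    f = refl
Σ≤-unroll (suc n) f = trans (cong (_+ f (suc (suc n))) (Σ≤-unroll n f)) (ℚ.+-assoc (f 0) _ _)

*-distribˡ-Σ≤ : ∀ n a (f : ℕ → ℚ) → a * Σ≤ n f ≡ Σ≤ n (λ i → a * f i)
*-distribˡ-Σ≤ zero    a f = refl
*-distribˡ-Σ≤ (suc n) a f =
  trans (ℚ.*-distribˡ-+ a (Σ≤ n f) (f (suc n))) (cong (_+ a * f (suc n)) (*-distribˡ-Σ≤ n a f))

geomSum : ℚ → ℕ → ℚ
geomSum y n = Σ≤ n (y ^_)

-- θ is the Euler operator y d/dy.
θgeomSum : ℚ → ℕ → ℚ
θgeomSum y n = Σ≤ n (λ i → ℕ→ℚ i * y ^ i)

geomSum-suc : ∀ y n → geomSum y (suc n) ≡ 1ℚ + y * geomSum y n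
geomSum-suc y n = trans (Σ≤-unroll n (y ^_)) (cong (λ s → 1ℚ + s) (sym (*-distribˡ-Σ≤ n y (y ^_))))

geomSum-nonNeg : ∀ {y} n → 0ℚ ≤ y → 0ℚ ≤ geomSum y n
geomSum-nonNeg n y≥0 = Σ≤-nonNeg n (λ i → ^-nonNeg i y≥0)

θgeomSum-nonNeg : ∀ {y} n → 0ℚ ≤ y → 0ℚ ≤ θgeomSum y n
θgeomSum-nonNeg n y≥0 = Σ≤-nonNeg n (λ i → *-nonNeg (ℕ→ℚ-nonNeg i) (^-nonNeg i y≥0))

1≤geomSum : ∀ {y} n → 0ℚ ≤ y → 1ℚ ≤ geomSum y n
1≤geomSum zero    _   = ℚ.≤-refl
1≤geomSum (suc n) y≥0 = subst (1ℚ ≤_) (sym (geomSum-suc _ n))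
  (ℚ.+-monoʳ-≤ 1ℚ (*-nonNeg y≥0 (geomSum-nonNeg n y≥0)))

geomSum-≤-fixpoint : ∀ {w Z} n → 0ℚ ≤ w → 0ℚ ≤ Z → 1ℚ + w * Z ≡ Z → geomSum w n ≤ Z
geomSum-≤-fixpoint zero    w≥0 Z≥0 fix = subst (1ℚ ≤_) fix (ℚ.+-monoʳ-≤ 1ℚ (*-nonNeg w≥0 Z≥0))
geomSum-≤-fixpoint {w} (suc n) w≥0 Z≥0 fix = subst₂ _≤_ (sym (geomSum-suc w n)) fix
  (ℚ.+-monoʳ-≤ 1ℚ (*-monoˡ-≤ w w≥0 (geomSum-≤-fixpoint n w≥0 Z≥0 fix)))

-- y · (tⁱ at t = w lies above its tangent line at t = y), arranged without subtraction.
tangent-term : ∀ {y w} i → 0ℚ ≤ y → 0ℚ ≤ w →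
  w * (ℕ→ℚ i * y ^ i) + y * y ^ i ≤ y * w ^ i + y * (ℕ→ℚ i * y ^ i)
tangent-term {y} {w} zero    _   _   = ℚ.≤-reflexive (base y w)
  where
  base : ∀ y w → w * (0ℚ * 1ℚ) + y * 1ℚ ≡ y * 1ℚ + y * (0ℚ * 1ℚ)
  base = solve 2 (λ y w →
    w :* (con 0ℚ :* con 1ℚ) :+ y :* con 1ℚ := y :* con 1ℚ :+ y :* (con 0ℚ :* con 1ℚ)) refl
tangent-term {y} {w} (suc j) y≥0 w≥0 = begin
  w * (ℕ→ℚ (suc j) * y ^ suc j) + y * y ^ suc j     ≡⟨ pull-y y w (y ^ j) (ℕ→ℚ (suc j)) ⟩
  y * (ℕ→ℚ (suc j) * (y ^ j * w)) + y * y ^ suc j   ≤⟨ ℚ.+-monoˡ-≤ (y * y ^ suc j) (*-monoˡ-≤ y y≥0 (amgm j y≥0 w≥0)) ⟩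
  y * (w ^ suc j + ℕ→ℚ j * y ^ suc j) + y * y ^ suc j
      ≡⟨ collect y (w ^ suc j) (y ^ suc j) (ℕ→ℚ j) ⟩
  y * w ^ suc j + y * ((1ℚ + ℕ→ℚ j) * y ^ suc j)
      ≡⟨ cong (λ c → y * w ^ suc j + y * (c * y ^ suc j)) (ℕ→ℚ-suc j) ⟨
  y * w ^ suc j + y * (ℕ→ℚ (suc j) * y ^ suc j)     ∎
  where
  open ℚ.≤-Reasoning
  pull-y : ∀ y w Y I → w * (I * (y * Y)) + y * (y * Y) ≡ y * (I * (Y * w)) + y * (y * Y)
  pull-y = solve 4 (λ y w Y I →
    w :* (I :* (y :* Y)) :+ y :* (y :* Y) := y :* (I :* (Y :* w)) :+ y :* (y :* Y)) refl
  collect : ∀ y W Y J → y * (W + J * Y) + y * Y ≡ y * W + y * ((1ℚ + J) * Y)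
  collect = solve 4 (λ y W Y J →
    y :* (W :+ J :* Y) :+ y :* Y := y :* W :+ y :* ((con 1ℚ :+ J) :* Y)) refl

tangent-geomSum : ∀ {y w} n → 0ℚ ≤ y → 0ℚ ≤ w →
  w * θgeomSum y n + y * geomSum y n ≤ y * geomSum w n + y * θgeomSum y n
tangent-geomSum {y} {w} n y≥0 w≥0 = begin
  w * θgeomSum y n + y * geomSum y n  ≡⟨ Σ≤-linear n w y _ _ ⟩
  Σ≤ n (λ i → w * (ℕ→ℚ i * y ^ i) + y * y ^ i)  ≤⟨ Σ≤-mono-≤ n (λ i → tangent-term i y≥0 w≥0) ⟩
  Σ≤ n (λ i → y * w ^ i + y * (ℕ→ℚ i * y ^ i))  ≡⟨ Σ≤-linear n y y _ _ ⟨
  y * geomSum w n + y * θgeomSum y n  ∎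
  where open ℚ.≤-Reasoning

euler-monomial : ∀ x j → x * (ℕ→ℚ j * x ^ (j ℕ.∸ 1)) ≡ ℕ→ℚ j * x ^ j
euler-monomial x zero    = ℚ.*-zeroʳ x
euler-monomial x (suc j) = swap x (ℕ→ℚ (suc j)) (x ^ j)
  where
  swap : ∀ x J X → x * (J * X) ≡ J * (x * X)
  swap = solve 3 (λ x J X → x :* (J :* X) := J :* (x :* X)) refl

φ≡geomSum : ∀ m d x → φ m d x ≡ geomSum (x ^ m) d
φ≡geomSum m d x = Σ≤-cong d (λ i → sym (^-*-assoc x m i))

xφ′≡θgeomSum : ∀ m d x → x * φ′ m d x ≡ ℕ→ℚ m * θgeomSum (x ^ m) d
xφ′≡θgeomSum m d x = begin
  x * φ′ m d x                                              ≡⟨ *-distribˡ-Σ≤ d x _ ⟩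
  Σ≤ d (λ i → x * (ℕ→ℚ (m ℕ.* i) * x ^ (m ℕ.* i ℕ.∸ 1)))  ≡⟨ Σ≤-cong d term ⟩
  Σ≤ d (λ i → ℕ→ℚ m * (ℕ→ℚ i * (x ^ m) ^ i))               ≡⟨ *-distribˡ-Σ≤ d (ℕ→ℚ m) _ ⟨
  ℕ→ℚ m * θgeomSum (x ^ m) d                                ∎
  where
  open ≡-Reasoning
  term : ∀ i → x * (ℕ→ℚ (m ℕ.* i) * x ^ (m ℕ.* i ℕ.∸ 1)) ≡ ℕ→ℚ m * (ℕ→ℚ i * (x ^ m) ^ i)
  term i = begin
    x * (ℕ→ℚ (m ℕ.* i) * x ^ (m ℕ.* i ℕ.∸ 1))  ≡⟨ euler-monomial x (m ℕ.* i) ⟩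
    ℕ→ℚ (m ℕ.* i) * x ^ (m ℕ.* i)              ≡⟨ cong₂ _*_ (ℕ→ℚ-* m i) (sym (^-*-assoc x m i)) ⟩
    ℕ→ℚ m * ℕ→ℚ i * (x ^ m) ^ i                ≡⟨ ℚ.*-assoc (ℕ→ℚ m) (ℕ→ℚ i) ((x ^ m) ^ i) ⟩
    ℕ→ℚ m * (ℕ→ℚ i * (x ^ m) ^ i)              ∎

-- α ≤ γ_m

subcritical-gap : ∀ d K {y w Z} → 0ℚ < y → 0ℚ ≤ w → 0ℚ ≤ Z → 1ℚ + w * Z ≡ Z →
  (1ℚ + K) * θgeomSum y d < geomSum y d →
  w * θgeomSum y d < y * (Z - K * θgeomSum y d)
subcritical-gap d K {y} {w} {Z} y>0 w≥0 Z≥0 fix subcritical = begin-strict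
  w * H                                           ≡⟨ expand w y H K ⟩
  w * H + y * ((1ℚ + K) * H) - y * H - y * (K * H)
      <⟨ ℚ.+-monoˡ-< (- (y * (K * H))) (ℚ.+-monoˡ-< (- (y * H))
           (ℚ.+-monoʳ-< (w * H) (ℚ.*-monoʳ-<-pos y {{ℚ.positive y>0}} subcritical))) ⟩
  w * H + y * G - y * H - y * (K * H)
      ≤⟨ ℚ.+-monoˡ-≤ (- (y * (K * H))) (ℚ.+-monoˡ-≤ (- (y * H)) (tangent-geomSum d y≥0 w≥0)) ⟩
  y * geomSum w d + y * H - y * H - y * (K * H)  ≡⟨ contract y (geomSum w d) H K ⟩
  y * (geomSum w d - K * H)
      ≤⟨ *-monoˡ-≤ y y≥0 (ℚ.+-monoˡ-≤ (- (K * H)) (geomSum-≤-fixpoint d w≥0 Z≥0 fix)) ⟩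
  y * (Z - K * H)                                 ∎
  where
  open ℚ.≤-Reasoning
  H = θgeomSum y d
  G = geomSum y d
  y≥0 = ℚ.<⇒≤ y>0
  expand : ∀ w y H K → w * H ≡ w * H + y * ((1ℚ + K) * H) - y * H - y * (K * H)
  expand = solve 4 (λ w y H K →
    w :* H := w :* H :+ y :* ((con 1ℚ :+ K) :* H) :- y :* H :- y :* (K :* H)) refl
  contract : ∀ y P H K → y * P + y * H - y * H - y * (K * H) ≡ y * (P - K * H)
  contract = solve 4 (λ y P H K → y :* P :+ y :* H :- y :* H :- y :* (K :* H) := y :* (P :- K :* H)) refl

geometric-fixpoint : ∀ k → let w = + 1 / suc (suc k); Z = + suc (suc k) / suc k in 1ℚ + w * Z ≡ Z
geometric-fixpoint k = begin
  1ℚ + w * Z           ≡⟨ cong (_+ w * Z) w*N≡1 ⟨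
  w * N + w * Z        ≡⟨ cong (λ c → w * c + w * Z) (/-*-cancel (suc (suc k)) (suc k)) ⟨
  w * (Z * M) + w * Z  ≡⟨ factor w Z M ⟩
  Z * (w * (1ℚ + M))   ≡⟨ cong (λ c → Z * (w * c)) (ℕ→ℚ-suc (suc k)) ⟨
  Z * (w * N)          ≡⟨ cong (Z *_) w*N≡1 ⟩
  Z * 1ℚ               ≡⟨ ℚ.*-identityʳ Z ⟩
  Z                    ∎
  where
  open ≡-Reasoning
  factor : ∀ w Z M → w * (Z * M) + w * Z ≡ Z * (w * (1ℚ + M))
  factor = solve 3 (λ w Z M → w :* (Z :* M) :+ w :* Z := Z :* (w :* (con 1ℚ :+ M))) refl
  w = + 1 / suc (suc k)
  Z = + suc (suc k) / suc k
  M = ℕ→ℚ (suc k)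
  N = ℕ→ℚ (suc (suc k))
  w*N≡1 : w * N ≡ 1ℚ
  w*N≡1 = /-*-cancel 1 (suc (suc k))

-- For d = ∞ the critical value τ^m is w = 1/(m+1), where geomSum w ∞ = Z = (m+1)/m.
subcritical-γ-bound : ∀ k d {y} → 0ℚ < y → ℕ→ℚ (suc k) * θgeomSum y d < geomSum y d →
  (ℕ→ℚ (suc k) * θgeomSum y d) ^ suc k ≤ γ (suc k) * y
subcritical-γ-bound k d {y} y>0 subcritical = ℚ.*-cancelʳ-≤-pos D {{ℚ.positive D>0}} (begin
  (ℕ→ℚ (suc k) * H) ^ suc k * D  ≤⟨ amgm-scaled k H≥0 Z≥0 ⟩
  H * Z ^ suc k                  ≡⟨ ℚ.*-identityˡ (H * Z ^ suc k) ⟨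
  1ℚ * (H * Z ^ suc k)           ≡⟨ cong (_* (H * Z ^ suc k)) (/-*-cancel 1 (suc (suc k))) ⟨
  w * N * (H * Z ^ suc k)        ≡⟨ regroup w N H (Z ^ suc k) ⟩
  γ (suc k) * (w * H)            ≤⟨ *-monoˡ-≤ (γ (suc k)) γ≥0 (ℚ.<⇒≤ gap) ⟩
  γ (suc k) * (y * D)            ≡⟨ ℚ.*-assoc (γ (suc k)) y D ⟨
  γ (suc k) * y * D              ∎)
  where
  open ℚ.≤-Reasoning
  regroup : ∀ w N h Y → w * N * (h * Y) ≡ N * Y * (w * h)
  regroup = solve 4 (λ w N h Y → w :* N :* (h :* Y) := N :* Y :* (w :* h)) refl
  N = ℕ→ℚ (suc (suc k))
  H = θgeomSum y d
  w = + 1 / suc (suc k)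
  Z = + suc (suc k) / suc k
  D = Z - ℕ→ℚ k * H
  y≥0 = ℚ.<⇒≤ y>0
  w≥0 : 0ℚ ≤ w
  w≥0 = ℚ.nonNegative⁻¹ w {{ℚ.normalize-nonNeg 1 (suc (suc k))}}
  Z≥0 : 0ℚ ≤ Z
  Z≥0 = ℚ.nonNegative⁻¹ Z {{ℚ.normalize-nonNeg (suc (suc k)) (suc k)}}
  H≥0 = θgeomSum-nonNeg d y≥0
  γ≥0 = *-nonNeg (ℕ→ℚ-nonNeg (suc (suc k))) (^-nonNeg (suc k) Z≥0)
  gap : w * H < y * D
  gap = subcritical-gap d (ℕ→ℚ k) y>0 w≥0 Z≥0 (geometric-fixpoint k)
          (subst (λ c → c * H < geomSum y d) (ℕ→ℚ-suc k) subcritical)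
  D>0 : 0ℚ < D
  D>0 = ℚ.*-cancelˡ-<-nonNeg y {{ℚ.nonNegative y≥0}}
          (subst (_< y * D) (sym (ℚ.*-zeroʳ y)) (ℚ.≤-<-trans (*-nonNeg w≥0 H≥0) gap))

φ′^m≤γ : ∀ m d .{{_ : NonZero m}} {x} → 0ℚ < x → x * φ′ m d x < φ m d x → φ′ m d x ^ m ≤ γ m
φ′^m≤γ m@(suc k) d {x} x>0 subcritical = *-cancelˡ-≤ (x ^ m) (^-pos m x>0) (begin
  x ^ m * φ′ m d x ^ m                ≡⟨ ^-distribʳ-* x (φ′ m d x) m ⟨
  (x * φ′ m d x) ^ m                  ≡⟨ cong (_^ m) (xφ′≡θgeomSum m d x) ⟩
  (ℕ→ℚ m * θgeomSum (x ^ m) d) ^ m    ≤⟨ subcritical-γ-bound k d (^-pos m x>0) subcritical′ ⟩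
  γ m * x ^ m                         ≡⟨ ℚ.*-comm (γ m) (x ^ m) ⟩
  x ^ m * γ m                         ∎)
  where
  open ℚ.≤-Reasoning
  subcritical′ : ℕ→ℚ m * θgeomSum (x ^ m) d < geomSum (x ^ m) d
  subcritical′ = subst₂ _<_ (xφ′≡θgeomSum m d x) (φ≡geomSum m d x) subcritical

-- Counting paths

count-interleave : ∀ {A B : Set} {P : Pred B 0ℓ} (P? : Decidable P) (f g : A → B) xs →
  length (filter P? (concatMap (λ x → f x ∷ g x ∷ []) xs))
    ≡ length (filter (P? ∘ f) xs) ℕ.+ length (filter (P? ∘ g) xs)
count-interleave P? f g [] = refl
count-interleave P? f g (x ∷ xs) with does (P? (f x))
... | true  with does (P? (g x))
...   | true  = cong suc (trans (cong suc (count-interleave P? f g xs)) (sym (ℕ.+-suc _ _)))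
...   | false = cong suc (count-interleave P? f g xs)
count-interleave P? f g (x ∷ xs) | false with does (P? (g x))
...   | true  = trans (cong suc (count-interleave P? f g xs)) (sym (ℕ.+-suc _ _))
...   | false = count-interleave P? f g xs

count-mono : ∀ {A : Set} {P Q : Pred A 0ℓ} (P? : Decidable P) (Q? : Decidable Q) →
  (∀ x → P x → Q x) → ∀ xs → length (filter P? xs) ℕ.≤ length (filter Q? xs)
count-mono P? Q? P⇒Q xs = length-mono-≤ (filter⁺ P? Q? (λ { refl → P⇒Q _ }) (⊆-refl {x = xs}))

allPaths-length : ∀ n → All (λ w → length w ≡ n) (allPaths n)
allPaths-length zero    = refl ∷ []
allPaths-length (suc n) = concat⁺ (map⁺ (All.map (λ eq → cong suc eq ∷ cong suc eq ∷ []) (allPaths-length n)))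

count-allPaths-suc : ∀ {P : Pred (List Step) 0ℓ} (P? : Decidable P) n →
  length (filter P? (allPaths (suc n)))
    ≡ length (filter (P? ∘ (rise ∷_)) (allPaths n)) ℕ.+ length (filter (P? ∘ (fall ∷_)) (allPaths n))
count-allPaths-suc P? n = count-interleave P? (rise ∷_) (fall ∷_) (allPaths n)

count-allPaths-none : ∀ {P : Pred (List Step) 0ℓ} (P? : Decidable P) n →
  (∀ w → length w ≡ n → ¬ P w) → length (filter P? (allPaths n)) ≡ 0
count-allPaths-none P? n ¬P = cong length (filter-none P? (All.map (¬P _) (allPaths-length n)))

walk-fall⁻ : ∀ m ℓ w {k} → walk m ℓ (fall ∷ w) ≡ just k → m ℕ.≤ ℓ × walk m (ℓ ℕ.∸ m) w ≡ just k
walk-fall⁻ m ℓ w h with m ℕ.≤? ℓ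
... | yes m≤ℓ = m≤ℓ , h
... | no _    = contradiction h λ ()

walk-descent-≤ : ∀ m ℓ w {k} → walk m ℓ w ≡ just k → ℓ ℕ.≤ k ℕ.+ m ℕ.* length w
walk-descent-≤ m ℓ []         refl = ℕ.m≤m+n ℓ (m ℕ.* 0)
walk-descent-≤ m ℓ (rise ∷ w) {k} h =
  ℕ.≤-trans (ℕ.n≤1+n ℓ) (ℕ.≤-trans (walk-descent-≤ m (suc ℓ) w h) (ℕ.+-monoʳ-≤ k (ℕ.*-monoʳ-≤ m (ℕ.n≤1+n _))))
walk-descent-≤ m ℓ (fall ∷ w) {k} h with walk-fall⁻ m ℓ w h
... | m≤ℓ , h′ = begin
  ℓ                                 ≡⟨ ℕ.m+[n∸m]≡n m≤ℓ ⟨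
  m ℕ.+ (ℓ ℕ.∸ m)                   ≤⟨ ℕ.+-monoʳ-≤ m (walk-descent-≤ m (ℓ ℕ.∸ m) w h′) ⟩
  m ℕ.+ (k ℕ.+ m ℕ.* length w)      ≡⟨ rearrange m k (length w) ⟩
  k ℕ.+ m ℕ.* suc (length w)        ∎
  where
  open ℕ.≤-Reasoning
  rearrange : ∀ m k n → m ℕ.+ (k ℕ.+ m ℕ.* n) ≡ k ℕ.+ m ℕ.* suc n
  rearrange = ℕ-Solver.solve-∀

level-after-fall : ∀ m {ℓ r f} → m ℕ.≤ ℓ → ℓ ℕ.+ r ≡ m ℕ.* suc f → ℓ ℕ.∸ m ℕ.+ r ≡ m ℕ.* f
level-after-fall m {ℓ} {r} {f} m≤ℓ ℓ≡ = ℕ.+-cancelˡ-≡ m _ _ (begin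
  m ℕ.+ (ℓ ℕ.∸ m ℕ.+ r)   ≡⟨ ℕ.+-assoc m (ℓ ℕ.∸ m) r ⟨
  m ℕ.+ (ℓ ℕ.∸ m) ℕ.+ r   ≡⟨ cong (ℕ._+ r) (ℕ.m+[n∸m]≡n m≤ℓ) ⟩
  ℓ ℕ.+ r                 ≡⟨ ℓ≡ ⟩
  m ℕ.* suc f             ≡⟨ ℕ.*-suc m f ⟩
  m ℕ.+ m ℕ.* f           ∎)
  where open ≡-Reasoning

≤-maxRun : ∀ c b w → b ℕ.≤ maxRun c b w
≤-maxRun c b []         = ℕ.≤-refl
≤-maxRun c b (rise ∷ w) = ≤-maxRun 0 b w
≤-maxRun c b (fall ∷ w) = ℕ.≤-trans (ℕ.m≤m⊔n b (suc c)) (≤-maxRun (suc c) (b ⊔ suc c) w)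

-- The suffixes of paths in D_m(·,0,·,d) read from level ℓ, inside a run of c falls,
-- after a longest run of b falls; InD m d is InDFrom m d 0 0 0.
InDFrom : (m d ℓ c b : ℕ) → Pred (List Step) 0ℓ
InDFrom m d ℓ c b w = walk m ℓ w ≡ just 0 × maxRun c b w ℕ.≤ d

InDFrom? : ∀ m d ℓ c b → Decidable (InDFrom m d ℓ c b)
InDFrom? m d ℓ c b w = maybe-≡-dec ℕ._≟_ (walk m ℓ w) (just 0) ×-dec (maxRun c b w ℕ.≤? d)

countFrom : (m d ℓ c b n : ℕ) → ℕ
countFrom m d ℓ c b n = length (filter (InDFrom? m d ℓ c b) (allPaths n))

InDFrom-fall⁻ : ∀ {m d ℓ c b w} → InDFrom m d ℓ c b (fall ∷ w) →
  m ℕ.≤ ℓ × InDFrom m d (ℓ ℕ.∸ m) (suc c) (b ⊔ suc c) w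
InDFrom-fall⁻ {m} {ℓ = ℓ} {w = w} (h , run) = map₂ (_, run) (walk-fall⁻ m ℓ w h)

InDFrom-fall-exhausted : ∀ {m d ℓ b w} → ¬ InDFrom m d ℓ d b (fall ∷ w)
InDFrom-fall-exhausted {d = d} {b = b} {w = w} (_ , run) =
  ℕ.≤⇒≯ run (ℕ.≤-trans (ℕ.m≤n⊔m b (suc d)) (≤-maxRun (suc d) (b ⊔ suc d) w))

-- A path from level 0 starts with a rise, which ends the initial (empty) run anyway.
InD⇒InDFrom-exhausted : ∀ {m d} .{{_ : NonZero m}} w → InD m d w → InDFrom m d 0 d 0 w
InD⇒InDFrom-exhausted []           p = p
InD⇒InDFrom-exhausted (rise ∷ w)   p = p
InD⇒InDFrom-exhausted {m} (fall ∷ w) (h , _) =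
  contradiction (proj₁ (walk-fall⁻ m 0 w h)) (ℕ.<⇒≱ (ℕ.>-nonZero⁻¹ m))

module _ (m d : ℕ) {y : ℚ} (y≥0 : 0ℚ ≤ y) where

  -- Weighting each of the f remaining falls by y: each of the r remaining rises may be
  -- followed by a run of at most d falls, and the current run by at most k more.
  Bound : ℕ → Set
  Bound n = ∀ ℓ c b {k r f} → c ℕ.+ k ≡ d → r ℕ.+ f ≡ n → ℓ ℕ.+ r ≡ m ℕ.* f →
            ℕ→ℚ (countFrom m d ℓ c b n) * y ^ f ≤ geomSum y d ^ r * geomSum y k

  private
    countAfterFall : (ℓ c b n : ℕ) → ℕ
    countAfterFall ℓ c b n = length (filter (InDFrom? m d ℓ c b ∘ (fall ∷_)) (allPaths n))

    vanishing : ∀ {N} f {q} → N ≡ 0 → 0ℚ ≤ q → ℕ→ℚ N * y ^ f ≤ q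
    vanishing f refl q≥0 = subst (_≤ _) (sym (ℚ.*-zeroˡ (y ^ f))) q≥0

    countFrom-suc : ∀ ℓ c b n f → ℕ→ℚ (countFrom m d ℓ c b (suc n)) * y ^ f
      ≡ ℕ→ℚ (countFrom m d (suc ℓ) 0 b n) * y ^ f + ℕ→ℚ (countAfterFall ℓ c b n) * y ^ f
    countFrom-suc ℓ c b n f = begin
      ℕ→ℚ (countFrom m d ℓ c b (suc n)) * y ^ f
        ≡⟨ cong (λ N → ℕ→ℚ N * y ^ f) (count-allPaths-suc (InDFrom? m d ℓ c b) n) ⟩
      ℕ→ℚ (countFrom m d (suc ℓ) 0 b n ℕ.+ countAfterFall ℓ c b n) * y ^ f
        ≡⟨ cong (_* y ^ f) (ℕ→ℚ-+ (countFrom m d (suc ℓ) 0 b n) (countAfterFall ℓ c b n)) ⟩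
      (ℕ→ℚ (countFrom m d (suc ℓ) 0 b n) + ℕ→ℚ (countAfterFall ℓ c b n)) * y ^ f
        ≡⟨ ℚ.*-distribʳ-+ (y ^ f) (ℕ→ℚ (countFrom m d (suc ℓ) 0 b n)) (ℕ→ℚ (countAfterFall ℓ c b n)) ⟩
      ℕ→ℚ (countFrom m d (suc ℓ) 0 b n) * y ^ f + ℕ→ℚ (countAfterFall ℓ c b n) * y ^ f ∎
      where open ≡-Reasoning

  bound-zero : Bound 0
  bound-zero ℓ c b {k} {zero} {zero} _ _ _ = begin
    ℕ→ℚ (countFrom m d ℓ c b 0) * 1ℚ
      ≤⟨ *-monoʳ-≤ 1ℚ (ℚ.nonNegative⁻¹ 1ℚ) (ℕ→ℚ-mono-≤ (length-filter (InDFrom? m d ℓ c b) ([] ∷ []))) ⟩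
    ℕ→ℚ 1 * 1ℚ                       ≤⟨ 1≤geomSum k y≥0 ⟩
    geomSum y k                       ≡⟨ ℚ.*-identityˡ (geomSum y k) ⟨
    1ℚ * geomSum y k                  ∎
    where open ℚ.≤-Reasoning
  bound-zero _ _ _ {r = zero}  {suc _} _ () _
  bound-zero _ _ _ {r = suc _}         _ () _

  rises-bound : ∀ {n} → Bound n → ∀ ℓ b {r f} → r ℕ.+ f ≡ suc n → ℓ ℕ.+ r ≡ m ℕ.* f →
    ℕ→ℚ (countFrom m d (suc ℓ) 0 b n) * y ^ f ≤ geomSum y d ^ r
  rises-bound {n} _ ℓ b {zero} refl ℓ≡ =
    vanishing (suc n) (count-allPaths-none (InDFrom? m d (suc ℓ) 0 b) n unreachable) (ℚ.nonNegative⁻¹ 1ℚ)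
    where
    m*n≤ℓ : m ℕ.* n ℕ.≤ ℓ
    m*n≤ℓ = ℕ.≤-trans (ℕ.*-monoʳ-≤ m (ℕ.n≤1+n n)) (ℕ.≤-reflexive (trans (sym ℓ≡) (ℕ.+-identityʳ ℓ)))
    unreachable : ∀ w → length w ≡ n → ¬ InDFrom m d (suc ℓ) 0 b w
    unreachable w len (h , _) =
      ℕ.<⇒≱ (ℕ.s≤s m*n≤ℓ) (subst (λ L → suc ℓ ℕ.≤ m ℕ.* L) len (walk-descent-≤ m (suc ℓ) w h))
  rises-bound {n} IH ℓ b {suc r} {f} rf ℓ≡ = begin
    ℕ→ℚ (countFrom m d (suc ℓ) 0 b n) * y ^ f
      ≤⟨ IH (suc ℓ) 0 b refl (ℕ.suc-injective rf) (trans (sym (ℕ.+-suc ℓ r)) ℓ≡) ⟩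
    geomSum y d ^ r * geomSum y d  ≡⟨ ℚ.*-comm (geomSum y d ^ r) (geomSum y d) ⟩
    geomSum y d ^ suc r            ∎
    where open ℚ.≤-Reasoning

  falls-descend : ∀ {n} → Bound n → ∀ ℓ c b {k r f} → suc c ℕ.+ k ≡ d → r ℕ.+ f ≡ n → ℓ ℕ.∸ m ℕ.+ r ≡ m ℕ.* f →
    ℕ→ℚ (countAfterFall ℓ c b n) * y ^ suc f ≤ y * (geomSum y d ^ r * geomSum y k)
  falls-descend {n} IH ℓ c b {k} {r} {f} run rf ℓ≡ = begin
    ℕ→ℚ (countAfterFall ℓ c b n) * (y * y ^ f)
      ≤⟨ *-monoʳ-≤ (y * y ^ f) (^-nonNeg (suc f) y≥0) (ℕ→ℚ-mono-≤ (count-mono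
           (InDFrom? m d ℓ c b ∘ (fall ∷_)) (InDFrom? m d ℓ′ (suc c) b′)
           (λ w p → proj₂ (InDFrom-fall⁻ {m} {d} {ℓ} {c} {b} {w} p)) (allPaths n))) ⟩
    ℕ→ℚ N * (y * y ^ f)          ≡⟨ swap (ℕ→ℚ N) y (y ^ f) ⟩
    y * (ℕ→ℚ N * y ^ f)          ≤⟨ *-monoˡ-≤ y y≥0 (IH ℓ′ (suc c) b′ run rf ℓ≡) ⟩
    y * (geomSum y d ^ r * geomSum y k) ∎
    where
    open ℚ.≤-Reasoning
    ℓ′ = ℓ ℕ.∸ m
    b′ = b ⊔ suc c
    N = countFrom m d ℓ′ (suc c) b′ n
    swap : ∀ N y Y → N * (y * Y) ≡ y * (N * Y)
    swap = solve 3 (λ N y Y → N :* (y :* Y) := y :* (N :* Y)) refl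

  falls-bound : ∀ {n} → Bound n → ∀ ℓ c b {k r f} → c ℕ.+ suc k ≡ d → r ℕ.+ f ≡ suc n → ℓ ℕ.+ r ≡ m ℕ.* f →
    ℕ→ℚ (countAfterFall ℓ c b n) * y ^ f ≤ y * (geomSum y d ^ r * geomSum y k)
  falls-bound _ ℓ c b {r = r} {zero} _ rf ℓ≡ =
    contradiction (trans (sym r≡0) (trans (sym (ℕ.+-identityʳ r)) rf)) ℕ.0≢1+n
    where
    r≡0 : r ≡ 0
    r≡0 = ℕ.m+n≡0⇒n≡0 ℓ (trans ℓ≡ (ℕ.*-zeroʳ m))
  falls-bound {n} IH ℓ c b {k} {r} {suc f} run rf ℓ≡ =
    [ (λ m≤ℓ → falls-descend IH ℓ c b (trans (sym (ℕ.+-suc c k)) run)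
                 (ℕ.suc-injective (trans (sym (ℕ.+-suc r f)) rf)) (level-after-fall m m≤ℓ ℓ≡))
    , (λ ℓ<m → vanishing (suc f) (falls-blocked ℓ<m)
                 (*-nonNeg y≥0 (*-nonNeg (^-nonNeg r Φ≥0) (geomSum-nonNeg k y≥0))))
    ]′ (ℕ.≤-<-connex m ℓ)
    where
    Φ≥0 = geomSum-nonNeg d y≥0
    falls-blocked : ℓ ℕ.< m → countAfterFall ℓ c b n ≡ 0
    falls-blocked ℓ<m = count-allPaths-none (InDFrom? m d ℓ c b ∘ (fall ∷_)) n
      (λ w _ p → ℕ.<⇒≱ ℓ<m (proj₁ (InDFrom-fall⁻ {m} {d} {ℓ} {c} {b} {w} p)))

  bound-suc : ∀ {n} → Bound n → Bound (suc n)
  bound-suc {n} IH ℓ c b {zero} {r} {f} run rf ℓ≡ = begin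
    ℕ→ℚ (countFrom m d ℓ c b (suc n)) * y ^ f  ≡⟨ countFrom-suc ℓ c b n f ⟩
    ℕ→ℚ (countFrom m d (suc ℓ) 0 b n) * y ^ f + ℕ→ℚ (countAfterFall ℓ c b n) * y ^ f
      ≤⟨ ℚ.+-mono-≤ (rises-bound IH ℓ b rf ℓ≡) (vanishing f exhausted ℚ.≤-refl) ⟩
    geomSum y d ^ r + 0ℚ                        ≡⟨ ℚ.+-identityʳ (geomSum y d ^ r) ⟩
    geomSum y d ^ r                             ≡⟨ ℚ.*-identityʳ (geomSum y d ^ r) ⟨
    geomSum y d ^ r * geomSum y 0               ∎
    where
    open ℚ.≤-Reasoning
    exhausted : countAfterFall ℓ c b n ≡ 0
    exhausted = count-allPaths-none (InDFrom? m d ℓ c b ∘ (fall ∷_)) n λ w _ →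
      subst (λ e → ¬ InDFrom m d ℓ e b (fall ∷ w)) (trans (sym run) (ℕ.+-identityʳ c))
            (InDFrom-fall-exhausted {m} {d} {ℓ} {b} {w})
  bound-suc {n} IH ℓ c b {suc k} {r} {f} run rf ℓ≡ = begin
    ℕ→ℚ (countFrom m d ℓ c b (suc n)) * y ^ f  ≡⟨ countFrom-suc ℓ c b n f ⟩
    ℕ→ℚ (countFrom m d (suc ℓ) 0 b n) * y ^ f + ℕ→ℚ (countAfterFall ℓ c b n) * y ^ f
      ≤⟨ ℚ.+-mono-≤ (rises-bound IH ℓ b rf ℓ≡) (falls-bound IH ℓ c b run rf ℓ≡) ⟩
    geomSum y d ^ r + y * (geomSum y d ^ r * geomSum y k)  ≡⟨ factor (geomSum y d ^ r) y (geomSum y k) ⟩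
    geomSum y d ^ r * (1ℚ + y * geomSum y k)               ≡⟨ cong (geomSum y d ^ r *_) (geomSum-suc y k) ⟨
    geomSum y d ^ r * geomSum y (suc k)                     ∎
    where
    open ℚ.≤-Reasoning
    factor : ∀ P y G → P + y * (P * G) ≡ P * (1ℚ + y * G)
    factor = solve 3 (λ P y G → P :+ y :* (P :* G) := P :* (con 1ℚ :+ y :* G)) refl

  bound : ∀ n → Bound n
  bound zero    = bound-zero
  bound (suc n) = bound-suc (bound n)

countD-weighted-≤ : ∀ m d .{{_ : NonZero m}} {y} → 0ℚ ≤ y → ∀ t →
  ℕ→ℚ (countD m (t ℕ.* suc m) d) * y ^ t ≤ geomSum y d ^ (m ℕ.* t)
countD-weighted-≤ m d {y} y≥0 t = begin
  ℕ→ℚ (countD m n d) * y ^ t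
    ≤⟨ *-monoʳ-≤ (y ^ t) (^-nonNeg t y≥0) (ℕ→ℚ-mono-≤
         (count-mono (InD? m d) (InDFrom? m d 0 d 0) InD⇒InDFrom-exhausted (allPaths n))) ⟩
  ℕ→ℚ (countFrom m d 0 d 0 n) * y ^ t
    ≤⟨ bound m d y≥0 n 0 d 0 (ℕ.+-identityʳ d) (steps m t) refl ⟩
  geomSum y d ^ (m ℕ.* t) * 1ℚ  ≡⟨ ℚ.*-identityʳ (geomSum y d ^ (m ℕ.* t)) ⟩
  geomSum y d ^ (m ℕ.* t)       ∎
  where
  open ℚ.≤-Reasoning
  n = t ℕ.* suc m
  steps : ∀ m t → m ℕ.* t ℕ.+ t ≡ t ℕ.* suc m
  steps = ℕ-Solver.solve-∀

countD-≤-α^t : ∀ m d .{{_ : NonZero m}} {x} → 0ℚ < x → φ m d x < x * φ′ m d x → ∀ t →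
  ℕ→ℚ (countD m (t ℕ.* suc m) d) ≤ (φ′ m d x ^ m) ^ t
countD-≤-α^t m d {x} x>0 supercritical t = *-cancelˡ-≤ ((x ^ m) ^ t) (^-pos t (^-pos m x>0)) (begin
  (x ^ m) ^ t * ℕ→ℚ (countD m (t ℕ.* suc m) d)  ≡⟨ ℚ.*-comm ((x ^ m) ^ t) _ ⟩
  ℕ→ℚ (countD m (t ℕ.* suc m) d) * (x ^ m) ^ t  ≤⟨ countD-weighted-≤ m d (^-nonNeg m x≥0) t ⟩
  geomSum (x ^ m) d ^ (m ℕ.* t)                  ≡⟨ cong (_^ (m ℕ.* t)) (φ≡geomSum m d x) ⟨
  φ m d x ^ (m ℕ.* t)                            ≤⟨ ^-mono-≤ (m ℕ.* t) φ≥0 (ℚ.<⇒≤ supercritical) ⟩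
  (x * φ′ m d x) ^ (m ℕ.* t)                     ≡⟨ ^-*-assoc (x * φ′ m d x) m t ⟨
  ((x * φ′ m d x) ^ m) ^ t                       ≡⟨ cong (_^ t) (^-distribʳ-* x (φ′ m d x) m) ⟩
  (x ^ m * φ′ m d x ^ m) ^ t                     ≡⟨ ^-distribʳ-* (x ^ m) (φ′ m d x ^ m) t ⟩
  (x ^ m) ^ t * (φ′ m d x ^ m) ^ t               ∎)
  where
  open ℚ.≤-Reasoning
  x≥0 = ℚ.<⇒≤ x>0
  φ≥0 : 0ℚ ≤ φ m d x
  φ≥0 = subst (0ℚ ≤_) (sym (φ≡geomSum m d x)) (geomSum-nonNeg d (^-nonNeg m x≥0))

-- The hypotheses d ≥ 1 and max(m, d) ≥ 2 only ensure that τ exists.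
lemma8 : (m d : ℕ) → .{{_ : NonZero m}} → 1 ℕ.≤ d → 2 ℕ.≤ m ⊔ d →
    -- ∃ c_a with |D_m(t(m+1),0,·,d)| ≤ c_a α^t, α = φ'(τ)^m, written via
    -- the cut {x ∈ ℚ | x > τ} = {x > 0 | φ(x) < x φ'(x)}
    (∃[ c ] ((t : ℕ) → 1 ℕ.≤ t → (x : ℚ) → 0ℚ ℚ.< x → φ m d x ℚ.< x ℚ.* φ′ m d x →
        ℕ→ℚ (countD m (t ℕ.* suc m) d) ℚ.≤ ℕ→ℚ c ℚ.* (φ′ m d x ^ m) ^ t))
    -- α ≤ γ_m, written via the cut {x ∈ ℚ | 0 < x < τ} = {x > 0 | φ(x) > x φ'(x)}
    × ((x : ℚ) → 0ℚ ℚ.< x → x ℚ.* φ′ m d x ℚ.< φ m d x → φ′ m d x ^ m ℚ.≤ γ m)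
lemma8 m d _ _ =
  (1 , λ t _ x x>0 supercritical →
         subst (_ ≤_) (sym (ℚ.*-identityˡ _)) (countD-≤-α^t m d x>0 supercritical t))
  , λ x x>0 subcritical → φ′^m≤γ m d x>0 subcritical
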